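{- Let $q$ be a prime power and let $G\in\mathbb{F}_q^{m\times n}$ have rank $m\le n$. Let $\mathcal{X}$ be a $k$-dimensional affine source over $\mathbb{F}_q^n$, i.e., uniform on $\{xA_G+a : x\in\mathbb{F}_q^k\}$ for some $A_G\in\mathbb{F}_q^{k\times n}$ of rank $k$ and $a\in\mathbb{F}_q^n$, and suppose that the linear mapping defined by $G$ is a $(k\log q)\to_0(k'\log q)$ condenser for $\mathcal{X}$, so that for $X\sim\mathcal{X}$ the distribution of $G\cdot X^\top$ has entropy at least $k'\log q$. Let $H\in\mathbb{F}_q^{(n-m)\times n}$ have rank $n-m$ and satisfy $GH^\top=0$, and let $\mathcal{Y}$ be an $(n-k)$-dimensional affine source over $\mathbb{F}_q^n$ supported on a translation of the dual subspace $\{v\in\mathbb{F}_q^n : vA_G^\top=0\}$. Then for $Y\sim\mathcal{Y}$, the distribution of $H\cdot Y^\top$ has entropy at least $(n-k+k'-m)\log q$.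
   Context: Logarithms are to base 2. An affine source is a uniform distribution on an affine subspace; the image of an affine source under a linear map is again uniform on an affine subspace, so its Shannon entropy and min-entropy coincide and equal $\log_2$ of the support size. A $(k\log q)\to_0(k'\log q)$ condenser for $\mathcal{X}$ means the output distribution on $\mathcal{X}$ has (min-)entropy at least $k'\log q$ exactly (error zero). -}

module Defs where

open import Level using (Level; _⊔_) renaming (suc to lsuc)
open import Data.Nat using (ℕ; zero; suc; _^_)
open import Data.Nat.Primality using (Prime)
open import Data.Fin using (Fin; zero; suc)
open import Data.Product using (Σ; ∃; _×_; _,_)
open import Relation.Nullary using (¬_)
open import Relation.Binary.PropositionalEquality using (_≡_)
open import Algebra.Bundles using (CommutativeRing)

IsPrimePower : ℕ → Set
IsPrimePower q = Σ ℕ λ p → Σ ℕ λ e → Prime p × (q ≡ p ^ suc e)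

record FiniteField (c ℓ : Level) : Set (lsuc (c ⊔ ℓ)) where
  field
    commRing : CommutativeRing c ℓ
  open CommutativeRing commRing public
  field
    0≉1       : ¬ (0# ≈ 1#)
    inverse   : ∀ x → ¬ (x ≈ 0#) → ∃ λ y → (x * y) ≈ 1#
    order     : ℕ
    enum      : Fin order → Carrier
    enum-surj : ∀ x → ∃ λ i → enum i ≈ x
    enum-inj  : ∀ i j → enum i ≈ enum j → i ≡ j

module FieldOps {c ℓ : Level} (F : FiniteField c ℓ) where
  open FiniteField F using (Carrier; _≈_; _+_; _*_; _-_; 0#; order)

  q : ℕ
  q = order

  Vec : ℕ → Set c
  Vec n = Fin n → Carrier

  Mat : ℕ → ℕ → Set c
  Mat m n = Fin m → Fin n → Carrier

  ∑ : ∀ {n} → (Fin n → Carrier) → Carrier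
  ∑ {zero}  f = 0#
  ∑ {suc n} f = f zero + ∑ (λ i → f (suc i))

  _≈ᵥ_ : ∀ {n} → Vec n → Vec n → Set ℓ
  u ≈ᵥ v = ∀ j → u j ≈ v j

  _+ᵥ_ : ∀ {n} → Vec n → Vec n → Vec n
  (u +ᵥ v) j = u j + v j

  _-ᵥ_ : ∀ {n} → Vec n → Vec n → Vec n
  (u -ᵥ v) j = u j - v j

  _·ᴹ_ : ∀ {m n} → Vec m → Mat m n → Vec n
  (x ·ᴹ M) j = ∑ (λ i → x i * M i j)

  _·ᵀ_ : ∀ {m n} → Mat m n → Vec n → Vec m
  (M ·ᵀ v) i = ∑ (λ j → M i j * v j)

  -- rank of an m×n matrix equals m: its rows are linearly independent
  HasRank= : ∀ {m n} → Mat m n → ℕ → Set (c ⊔ ℓ)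
  HasRank= {m} M r = (r ≡ m) × (∀ x → (∀ j → (x ·ᴹ M) j ≈ 0#) → ∀ i → x i ≈ 0#)

  record AffineSource (k n : ℕ) : Set (c ⊔ ℓ) where
    field
      A     : Mat k n
      a     : Vec n
      rankA : HasRank= A k
    point : Vec k → Vec n
    point x = (x ·ᴹ A) +ᵥ a

  supportImage : ∀ {k n m} → Mat m n → AffineSource k n → Vec m → Set (c ⊔ ℓ)
  supportImage M X w = ∃ λ x → w ≈ᵥ (M ·ᵀ AffineSource.point X x)

  CardAtLeast : ∀ {m} → (Vec m → Set (c ⊔ ℓ)) → ℕ → Set (c ⊔ ℓ)
  CardAtLeast {m} S N =
    Σ (Fin N → Vec m) λ f → (∀ i → S (f i)) × (∀ i j → f i ≈ᵥ f j → i ≡ j)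

  -- The distribution of M·X^T (uniform on an affine subspace) has entropy
  -- at least t·log q, i.e. log₂ |support| ≥ t log₂ q, i.e. |support| ≥ q^t.
  EntropyAtLeast : ∀ {k n m} → Mat m n → AffineSource k n → ℕ → Set (c ⊔ ℓ)
  EntropyAtLeast M X t = CardAtLeast (supportImage M X) (q ^ t)

  IsCondenser : ∀ {k n m} → Mat m n → AffineSource k n → ℕ → Set (c ⊔ ℓ)
  IsCondenser G X k' = EntropyAtLeast G X k'

  InDual : ∀ {k n} → Mat k n → Vec n → Set ℓ
  InDual A v = ∀ i → ∑ (λ j → v j * A i j) ≈ 0#

  OrthRows : ∀ {m m' n} → Mat m n → Mat m' n → Set ℓ
  OrthRows G H = ∀ i l → ∑ (λ j → G i j * H l j) ≈ 0#

-- Write A, B for the generator matrices of 𝒳 and 𝒴. An affine source pushed through a linear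
-- map is an affine copy of a row space, so H·Yᵀ has q^rank(B Hᵀ) points and the condenser
-- hypothesis says rank(G Aᵀ) ≥ k'. By rank–nullity it therefore suffices to show that the left
-- kernel of B Hᵀ is no larger than that of G Aᵀ. Since rank G + rank H = n and G Hᵀ = 0, the
-- vectors orthogonal to the rows of H are exactly the row space of G; so y ↦ y B carries the left
-- kernel of B Hᵀ injectively to vectors z G, and B Aᵀ = 0 forces z into the left kernel of G Aᵀ.

module Submission where

open import Defs
open import Level using (Level; _⊔_)
open import Function using (_∘_)
open import Data.Nat as ℕ using (ℕ; zero; suc; _≤_; _<_)
import Data.Nat.Properties as ℕₚ
open import Data.Fin as Fin using (Fin; zero; suc; funToFin; finToFun)
import Data.Fin.Properties as Finₚ
open import Data.Vec.Functional using (_∷_; tail)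
open import Data.Product using (∃; _,_; proj₁; proj₂)
open import Relation.Nullary using (¬_; Dec; yes; no)
open import Relation.Nullary.Negation using (contradiction)
open import Relation.Binary.PropositionalEquality as ≡ using (_≡_; _≗_)
import Algebra.Properties.Ring as RingProperties
import Algebra.Properties.Semiring.Sum as SumProperties

funToFin-cong : ∀ {m n} {f g : Fin m → Fin n} → f ≗ g → funToFin f ≡ funToFin g
funToFin-cong {zero}  f≗g = ≡.refl
funToFin-cong {suc m} f≗g = ≡.cong₂ Fin.combine (f≗g zero) (funToFin-cong (f≗g ∘ suc))

rank-nullity-bound : ∀ {d m k' r₁ s₁ r₂ s₂} → r₁ ℕ.+ s₁ ≡ d → r₂ ℕ.+ s₂ ≡ m → s₁ ≤ s₂ → k' ≤ r₂ →
  d ℕ.+ k' ℕ.∸ m ≤ r₁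
rank-nullity-bound {k' = k'} {r₁} {s₁} {r₂} {s₂} ≡.refl ≡.refl s₁≤s₂ k'≤r₂ =
  ℕₚ.m≤n+o⇒m∸n≤o (r₁ ℕ.+ s₁ ℕ.+ k') (r₂ ℕ.+ s₂) (begin
    r₁ ℕ.+ s₁ ℕ.+ k'      ≡⟨ ℕₚ.+-assoc r₁ s₁ k' ⟩
    r₁ ℕ.+ (s₁ ℕ.+ k')    ≤⟨ ℕₚ.+-monoʳ-≤ r₁ (ℕₚ.+-mono-≤ s₁≤s₂ k'≤r₂) ⟩
    r₁ ℕ.+ (s₂ ℕ.+ r₂)    ≡⟨ ℕₚ.+-comm r₁ (s₂ ℕ.+ r₂) ⟩
    s₂ ℕ.+ r₂ ℕ.+ r₁      ≡⟨ ≡.cong (ℕ._+ r₁) (ℕₚ.+-comm s₂ r₂) ⟩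
    r₂ ℕ.+ s₂ ℕ.+ r₁      ∎)
  where open ℕₚ.≤-Reasoning

module LinearAlgebra {c ℓ : Level} (F : FiniteField c ℓ) where
  open FiniteField F hiding (zero)
  open FieldOps F
  open RingProperties ring using (-‿distribˡ-*; -‿distribʳ-*; -‿+-comm; -0#≈0#; +-cancelʳ; +-inverseˡ-unique; x∙y⁻¹≈ε⇒x≈y; x≈y⇒x∙y⁻¹≈ε)
  private module Σ = SumProperties semiring
  open import Relation.Binary.Reasoning.Setoid setoid

  ∑≡sum : ∀ {n} (f : Vec n) → ∑ f ≡ Σ.sum f
  ∑≡sum {zero}  f = ≡.refl
  ∑≡sum {suc n} f = ≡.cong (f zero +_) (∑≡sum (tail f))

  ∑-cong : ∀ {n} {f g : Vec n} → (∀ i → f i ≈ g i) → ∑ f ≈ ∑ g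
  ∑-cong {f = f} {g} f≈g = begin
    ∑ f      ≡⟨ ∑≡sum f ⟩
    Σ.sum f  ≈⟨ Σ.sum-cong-≋ f≈g ⟩
    Σ.sum g  ≡⟨ ∑≡sum g ⟨
    ∑ g      ∎

  ∑-zero : ∀ {n} → ∑ {n} (λ _ → 0#) ≈ 0#
  ∑-zero {n} = trans (reflexive (∑≡sum {n} (λ _ → 0#))) (Σ.sum-replicate-zero n)

  ∑-distrib-+ : ∀ {n} (f g : Vec n) → ∑ (λ i → f i + g i) ≈ ∑ f + ∑ g
  ∑-distrib-+ f g rewrite ∑≡sum (λ i → f i + g i) | ∑≡sum f | ∑≡sum g = Σ.∑-distrib-+ f g

  ∑-comm : ∀ {m n} (f : Fin m → Fin n → Carrier) →
           ∑ (λ i → ∑ (λ j → f i j)) ≈ ∑ (λ j → ∑ (λ i → f i j))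
  ∑-comm f = begin
    ∑ (λ i → ∑ (f i))                      ≡⟨ ∑≡sum (λ i → ∑ (f i)) ⟩
    Σ.sum (λ i → ∑ (f i))                  ≈⟨ Σ.sum-cong-≋ (λ i → reflexive (∑≡sum (f i))) ⟩
    Σ.sum (λ i → Σ.sum (f i))              ≈⟨ Σ.∑-comm f ⟩
    Σ.sum (λ j → Σ.sum (λ i → f i j))      ≈⟨ Σ.sum-cong-≋ (λ j → reflexive (∑≡sum (λ i → f i j))) ⟨
    Σ.sum (λ j → ∑ (λ i → f i j))          ≡⟨ ∑≡sum (λ j → ∑ (λ i → f i j)) ⟨
    ∑ (λ j → ∑ (λ i → f i j))              ∎

  *-distribˡ-∑ : ∀ {n} x (f : Vec n) → x * ∑ f ≈ ∑ (λ i → x * f i)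
  *-distribˡ-∑ x f rewrite ∑≡sum f | ∑≡sum (λ i → x * f i) = Σ.*-distribˡ-sum x f

  *-distribʳ-∑ : ∀ {n} x (f : Vec n) → ∑ f * x ≈ ∑ (λ i → f i * x)
  *-distribʳ-∑ x f rewrite ∑≡sum f | ∑≡sum (λ i → f i * x) = Σ.*-distribʳ-sum x f

  ∑-neg : ∀ {n} (f : Vec n) → ∑ (λ i → - f i) ≈ - ∑ f
  ∑-neg {zero}  f = sym -0#≈0#
  ∑-neg {suc n} f = trans (+-congˡ (∑-neg (tail f))) (-‿+-comm (f zero) (∑ (tail f)))

  0ᵥ : ∀ {n} → Vec n
  0ᵥ _ = 0#

  negᵥ : ∀ {n} → Vec n → Vec n
  negᵥ u i = - u i

  _*ᵥ_ : ∀ {n} → Carrier → Vec n → Vec n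
  (a *ᵥ u) i = a * u i

  infixl 30 _ᵀ
  _ᵀ : ∀ {a b} → Mat a b → Mat b a
  (M ᵀ) j i = M i j

  _·ᴹᴹ_ : ∀ {a b d} → Mat a b → Mat b d → Mat a d
  (U ·ᴹᴹ M) i = U i ·ᴹ M

  ·ᴹ-congˡ : ∀ {a b} {u v : Vec a} (M : Mat a b) → u ≈ᵥ v → (u ·ᴹ M) ≈ᵥ (v ·ᴹ M)
  ·ᴹ-congˡ M u≈v j = ∑-cong (λ i → *-congʳ (u≈v i))

  ·ᴹ-congʳ : ∀ {a b} (u : Vec a) {M M' : Mat a b} → (∀ i j → M i j ≈ M' i j) → (u ·ᴹ M) ≈ᵥ (u ·ᴹ M')
  ·ᴹ-congʳ u M≈M' j = ∑-cong (λ i → *-congˡ (M≈M' i j))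

  ∑-*-zeroʳ : ∀ {n} (v : Vec n) → ∑ (λ i → v i * 0#) ≈ 0#
  ∑-*-zeroʳ {n} v = trans (∑-cong (λ i → zeroʳ (v i))) (∑-zero {n})

  ·ᴹ-zeroˡ : ∀ {a b} (M : Mat a b) → (0ᵥ ·ᴹ M) ≈ᵥ 0ᵥ
  ·ᴹ-zeroˡ {a} M j = trans (∑-cong (λ i → zeroˡ (M i j))) (∑-zero {a})

  ·ᴹ-distribʳ-+ᵥ : ∀ {a b} (u v : Vec a) (M : Mat a b) → ((u +ᵥ v) ·ᴹ M) ≈ᵥ ((u ·ᴹ M) +ᵥ (v ·ᴹ M))
  ·ᴹ-distribʳ-+ᵥ u v M j =
    trans (∑-cong (λ i → distribʳ (M i j) (u i) (v i))) (∑-distrib-+ (λ i → u i * M i j) (λ i → v i * M i j))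

  ·ᴹ-negᵥ : ∀ {a b} (u : Vec a) (M : Mat a b) → (negᵥ u ·ᴹ M) ≈ᵥ negᵥ (u ·ᴹ M)
  ·ᴹ-negᵥ u M j = trans (∑-cong (λ i → sym (-‿distribˡ-* (u i) (M i j)))) (∑-neg (λ i → u i * M i j))

  ·ᴹ-*ᵥ : ∀ {a b} x (u : Vec a) (M : Mat a b) → ((x *ᵥ u) ·ᴹ M) ≈ᵥ (x *ᵥ (u ·ᴹ M))
  ·ᴹ-*ᵥ x u M j = trans (∑-cong (λ i → *-assoc x (u i) (M i j))) (sym (*-distribˡ-∑ x (λ i → u i * M i j)))

  ·ᴹ-assoc : ∀ {a b d} (x : Vec a) (U : Mat a b) (M : Mat b d) → (x ·ᴹ (U ·ᴹᴹ M)) ≈ᵥ ((x ·ᴹ U) ·ᴹ M)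
  ·ᴹ-assoc x U M j = begin
    ∑ (λ i → x i * ∑ (λ p → U i p * M p j))    ≈⟨ ∑-cong (λ i → *-distribˡ-∑ (x i) (λ p → U i p * M p j)) ⟩
    ∑ (λ i → ∑ (λ p → x i * (U i p * M p j)))  ≈⟨ ∑-comm (λ i p → x i * (U i p * M p j)) ⟩
    ∑ (λ p → ∑ (λ i → x i * (U i p * M p j)))  ≈⟨ ∑-cong (λ p → ∑-cong (λ i → sym (*-assoc (x i) (U i p) (M p j)))) ⟩
    ∑ (λ p → ∑ (λ i → x i * U i p * M p j))    ≈⟨ ∑-cong (λ p → sym (*-distribʳ-∑ (M p j) (λ i → x i * U i p))) ⟩
    ∑ (λ p → ∑ (λ i → x i * U i p) * M p j)    ∎

  ·ᴹᴹ-ᵀ : ∀ {a b p} (U : Mat a p) (V : Mat b p) → ∀ j i → ((U ·ᴹᴹ V ᵀ) ᵀ) j i ≈ (V ·ᴹᴹ U ᵀ) j i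
  ·ᴹᴹ-ᵀ U V j i = ∑-cong (λ t → *-comm (U i t) (V j t))

  ·ᵀ≈·ᴹᵀ : ∀ {m n} (K : Mat m n) (v : Vec n) → (K ·ᵀ v) ≈ᵥ (v ·ᴹ K ᵀ)
  ·ᵀ≈·ᴹᵀ K v i = ∑-cong (λ j → *-comm (K i j) (v j))

  -- Counting vectors over a finite field

  index : Carrier → Fin q
  index x = proj₁ (enum-surj x)

  enum-index : ∀ x → enum (index x) ≈ x
  enum-index x = proj₂ (enum-surj x)

  index-injective : ∀ {x y} → index x ≡ index y → x ≈ y
  index-injective {x} {y} i≡j = trans (sym (enum-index x)) (trans (reflexive (≡.cong enum i≡j)) (enum-index y))

  _≟_ : (x y : Carrier) → Dec (x ≈ y)
  x ≟ y with index x Fin.≟ index y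
  ... | yes i≡j = yes (index-injective i≡j)
  ... | no  i≢j = no λ x≈y → i≢j (enum-inj _ _ (trans (enum-index x) (trans x≈y (sym (enum-index y)))))

  _≟ᵥ_ : ∀ {n} (u v : Vec n) → Dec (u ≈ᵥ v)
  u ≟ᵥ v = Finₚ.all? (λ j → u j ≟ v j)

  encode : ∀ {d} → Vec d → Fin (q ℕ.^ d)
  encode u = funToFin (index ∘ u)

  decode : ∀ {d} → Fin (q ℕ.^ d) → Vec d
  decode {d} i j = enum (finToFun {q} {d} i j)

  decode-encode : ∀ {d} (u : Vec d) → decode (encode u) ≈ᵥ u
  decode-encode u j = trans (reflexive (≡.cong enum (Finₚ.finToFun-funToFin (index ∘ u) j))) (enum-index (u j))

  encode-injective : ∀ {d} {u v : Vec d} → encode u ≡ encode v → u ≈ᵥ v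
  encode-injective {u = u} {v} e j =
    trans (sym (decode-encode u j)) (trans (reflexive (≡.cong (λ i → decode i j) e)) (decode-encode v j))

  decode-injective : ∀ {d} (i j : Fin (q ℕ.^ d)) → decode {d} i ≈ᵥ decode j → i ≡ j
  decode-injective {d} i j e = ≡.trans (≡.sym (Finₚ.funToFin-finToFin {d} {q} i))
    (≡.trans (funToFin-cong (λ t → enum-inj _ _ (e t))) (Finₚ.funToFin-finToFin {d} {q} j))

  injection⇒≤ : ∀ {N d} (f : Fin N → Vec d) → (∀ i j → f i ≈ᵥ f j → i ≡ j) → N ≤ q ℕ.^ d
  injection⇒≤ f f-injective = Finₚ.injective⇒≤ {f = encode ∘ f} (f-injective _ _ ∘ encode-injective)

  1<q : 1 < q
  1<q = Finₚ.injective⇒≤ {f = index ∘ bit} bit-injective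
    where
    bit : Fin 2 → Carrier
    bit zero    = 0#
    bit (suc _) = 1#

    bit-injective : ∀ {i j} → index (bit i) ≡ index (bit j) → i ≡ j
    bit-injective {zero}     {zero}     _ = ≡.refl
    bit-injective {zero}     {suc zero} e = contradiction (index-injective e) 0≉1
    bit-injective {suc zero} {zero}     e = contradiction (sym (index-injective e)) 0≉1
    bit-injective {suc zero} {suc zero} _ = ≡.refl

  ^-cancelʳ-≤ : ∀ {a b} → q ℕ.^ a ≤ q ℕ.^ b → a ≤ b
  ^-cancelʳ-≤ qᵃ≤qᵇ = ℕₚ.≮⇒≥ λ b<a → ℕₚ.≤⇒≯ qᵃ≤qᵇ (ℕₚ.^-monoʳ-< q 1<q b<a)

  CardAtLeast-injection : ∀ {d m} (S : Vec m → Set (c ⊔ ℓ)) (h : Vec d → Vec m) →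
    (∀ u → S (h u)) → (∀ u v → h u ≈ᵥ h v → u ≈ᵥ v) → CardAtLeast S (q ℕ.^ d)
  CardAtLeast-injection S h h∈S h-injective =
    h ∘ decode , h∈S ∘ decode , λ i j e → decode-injective i j (h-injective _ _ e)

  EntropyAtLeast-mono : ∀ {k n m t t'} {K : Mat m n} {X : AffineSource k n} →
    t' ≤ t → EntropyAtLeast K X t → EntropyAtLeast K X t'
  EntropyAtLeast-mono {t = t} {t'} t'≤t (f , f∈S , f-injective) =
    f ∘ inject , f∈S ∘ inject , λ i j e → Finₚ.inject≤-injective qᵗ'≤qᵗ qᵗ'≤qᵗ i j (f-injective _ _ e)
    where
    qᵗ'≤qᵗ : q ℕ.^ t' ≤ q ℕ.^ t
    qᵗ'≤qᵗ = ℕₚ.^-monoʳ-≤ q {{ℕ.>-nonZero (ℕₚ.<-trans ℕ.z<s 1<q)}} t'≤t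
    inject : Fin (q ℕ.^ t') → Fin (q ℕ.^ t)
    inject i = Fin.inject≤ i qᵗ'≤qᵗ

  -- Independence and span

  Independent : ∀ {d b} → Mat d b → Set (c ⊔ ℓ)
  Independent E = ∀ x → (x ·ᴹ E) ≈ᵥ 0ᵥ → x ≈ᵥ 0ᵥ

  InSpan : ∀ {d b} → Mat d b → Vec b → Set (c ⊔ ℓ)
  InSpan {d} E v = ∃ λ (u : Vec d) → (u ·ᴹ E) ≈ᵥ v

  inSpan? : ∀ {d b} (E : Mat d b) (v : Vec b) → Dec (InSpan E v)
  inSpan? {d} E v with Finₚ.any? (λ i → (decode {d} i ·ᴹ E) ≟ᵥ v)
  ... | yes (i , e) = yes (decode i , e)
  ... | no ∄i = no λ (u , e) → ∄i (encode u , λ j → trans (·ᴹ-congˡ E (decode-encode u) j) (e j))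

  independent⇒injective : ∀ {d b} {E : Mat d b} → Independent E → ∀ {u v} → (u ·ᴹ E) ≈ᵥ (v ·ᴹ E) → u ≈ᵥ v
  independent⇒injective {E = E} E-independent {u} {v} e i = x∙y⁻¹≈ε⇒x≈y (u i) (v i) (E-independent (u -ᵥ v) diff i)
    where
    diff : ((u -ᵥ v) ·ᴹ E) ≈ᵥ 0ᵥ
    diff j = trans (·ᴹ-distribʳ-+ᵥ u (negᵥ v) E j) (trans (+-congˡ (·ᴹ-negᵥ v E j)) (x≈y⇒x∙y⁻¹≈ε (e j)))

  independent⇒≤ : ∀ {d b} {E : Mat d b} → Independent E → d ≤ b
  independent⇒≤ {d} {E = E} E-independent = ^-cancelʳ-≤ (injection⇒≤ (λ i → decode {d} i ·ᴹ E)
    (λ i j e → decode-injective i j (independent⇒injective E-independent e)))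

  independent-of-factor : ∀ {a b d} {U : Mat a b} {E : Mat b d} {M : Mat a d} →
    (∀ i → (U i ·ᴹ E) ≈ᵥ M i) → Independent M → Independent U
  independent-of-factor {U = U} {E} {M} U·E≈M M-independent x x·U≈0 = M-independent x λ j → begin
    (x ·ᴹ M) j           ≈⟨ ·ᴹ-congʳ x (λ i j → sym (U·E≈M i j)) j ⟩
    (x ·ᴹ (U ·ᴹᴹ E)) j   ≈⟨ ·ᴹ-assoc x U E j ⟩
    ((x ·ᴹ U) ·ᴹ E) j    ≈⟨ ·ᴹ-congˡ E x·U≈0 j ⟩
    (0ᵥ ·ᴹ E) j          ≈⟨ ·ᴹ-zeroˡ E j ⟩
    0#                   ∎

  independent-·ᴹᴹ : ∀ {a b d} {U : Mat a b} {E : Mat b d} → Independent U → Independent E → Independent (U ·ᴹᴹ E)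
  independent-·ᴹᴹ {U = U} {E} U-independent E-independent x x·UE≈0 =
    U-independent x (E-independent (x ·ᴹ U) λ j → trans (sym (·ᴹ-assoc x U E j)) (x·UE≈0 j))

  independent-rows-in-span⇒≤ : ∀ {s t b} {Z : Mat s b} {N : Mat t b} →
    Independent Z → (∀ p → InSpan N (Z p)) → s ≤ t
  independent-rows-in-span⇒≤ Z-independent Z⊆N =
    independent⇒≤ (independent-of-factor (λ p → proj₂ (Z⊆N p)) Z-independent)

  a*y≈1⇒a*v+t≈0⇒v≈-y*t : ∀ {a y v t} → a * y ≈ 1# → a * v + t ≈ 0# → v ≈ - y * t
  a*y≈1⇒a*v+t≈0⇒v≈-y*t {a} {y} {v} {t} a*y≈1 a*v+t≈0 = begin
    v            ≈⟨ *-identityˡ v ⟨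
    1# * v       ≈⟨ *-congʳ (trans (sym a*y≈1) (*-comm a y)) ⟩
    y * a * v    ≈⟨ *-assoc y a v ⟩
    y * (a * v)  ≈⟨ *-congˡ (+-inverseˡ-unique (a * v) t a*v+t≈0) ⟩
    y * - t      ≈⟨ -‿distribʳ-* y t ⟨
    - (y * t)    ≈⟨ -‿distribˡ-* y t ⟩
    - y * t      ∎

  ·ᴹ-head≈0 : ∀ {d b} (x : Vec (suc d)) (M : Mat (suc d) b) → x zero ≈ 0# → (x ·ᴹ M) ≈ᵥ (tail x ·ᴹ tail M)
  ·ᴹ-head≈0 x M x₀≈0 j = trans (+-congʳ (trans (*-congʳ x₀≈0) (zeroˡ (M zero j)))) (+-identityˡ _)

  ∉span⇒leading≈0 : ∀ {d b} {E : Mat d b} {v : Vec b} → ¬ InSpan E v →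
    ∀ a u → ((a ∷ u) ·ᴹ (v ∷ E)) ≈ᵥ 0ᵥ → a ≈ 0#
  ∉span⇒leading≈0 {E = E} {v} v∉E a u au·vE≈0 with a ≟ 0#
  ... | yes a≈0 = a≈0
  ... | no  a≉0 = contradiction ((- y) *ᵥ u , λ j → trans (·ᴹ-*ᵥ (- y) u E j)
                                   (sym (a*y≈1⇒a*v+t≈0⇒v≈-y*t a*y≈1 (au·vE≈0 j)))) v∉E
    where
    y : Carrier
    y = proj₁ (inverse a a≉0)
    a*y≈1 : a * y ≈ 1#
    a*y≈1 = proj₂ (inverse a a≉0)

  independent-∷ : ∀ {d b} {E : Mat d b} {v : Vec b} → Independent E → ¬ InSpan E v → Independent (v ∷ E)
  independent-∷ {E = E} {v} E-independent v∉E x x·vE≈0 = λ where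
      zero    → x₀≈0
      (suc i) → E-independent (tail x) tail≈0 i
    where
    x₀≈0 : x zero ≈ 0#
    x₀≈0 = ∉span⇒leading≈0 v∉E (x zero) (tail x) x·vE≈0
    tail≈0 : (tail x ·ᴹ E) ≈ᵥ 0ᵥ
    tail≈0 j = trans (sym (·ᴹ-head≈0 x (v ∷ E) x₀≈0 j)) (x·vE≈0 j)

  independent-spans : ∀ {m s} (C : Mat m s) → Independent C → s ≤ m → ∀ w → InSpan C w
  independent-spans C C-independent s≤m w with inSpan? C w
  ... | yes w∈C = w∈C
  ... | no  w∉C = contradiction (ℕₚ.≤-trans (independent⇒≤ {E = w ∷ C} (independent-∷ C-independent w∉C)) s≤m) ℕₚ.1+n≰n

  -- Rank–nullity

  record RankNullity {a b} (M : Mat a b) : Set (c ⊔ ℓ) where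
    field
      rank nullity       : ℕ
      rank+nullity       : rank ℕ.+ nullity ≡ a
      basis              : Mat rank b
      basis-independent  : Independent basis
      image⊆span         : ∀ x → InSpan basis (x ·ᴹ M)
      span⊆image         : ∀ u → ∃ λ x → (x ·ᴹ M) ≈ᵥ (u ·ᴹ basis)
      row∈span           : ∀ i → InSpan basis (M i)
      kernel             : Mat nullity a
      kernel-independent : Independent kernel
      kernel-annihilates : ∀ p → (kernel p ·ᴹ M) ≈ᵥ 0ᵥ
      kernel-spans       : ∀ x → (x ·ᴹ M) ≈ᵥ 0ᵥ → InSpan kernel x

  rankNullity-∈span : ∀ {a b} (M : Mat (suc a) b) (D : RankNullity (tail M)) →
    InSpan (RankNullity.basis D) (M zero) → RankNullity M
  rankNullity-∈span {a} M D (u₀ , u₀·E≈M₀) = record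
    { rank = D.rank ; nullity = suc D.nullity
    ; rank+nullity = ≡.trans (ℕₚ.+-suc D.rank D.nullity) (≡.cong suc D.rank+nullity)
    ; basis = D.basis ; basis-independent = D.basis-independent
    ; image⊆span = image⊆span ; span⊆image = span⊆image
    ; row∈span = λ where zero → u₀ , u₀·E≈M₀
                         (suc i) → D.row∈span i
    ; kernel = kernel ; kernel-independent = kernel-independent
    ; kernel-annihilates = kernel-annihilates ; kernel-spans = kernel-spans }
    where
    module D = RankNullity D
    w : Vec a
    w = proj₁ (D.span⊆image u₀)
    w·M'≈M₀ : (w ·ᴹ tail M) ≈ᵥ M zero
    w·M'≈M₀ j = trans (proj₂ (D.span⊆image u₀) j) (u₀·E≈M₀ j)

    image⊆span : ∀ x → InSpan D.basis (x ·ᴹ M)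
    image⊆span x = (x zero *ᵥ u₀) +ᵥ v , λ j →
      trans (·ᴹ-distribʳ-+ᵥ (x zero *ᵥ u₀) v D.basis j)
            (+-cong (trans (·ᴹ-*ᵥ (x zero) u₀ D.basis j) (*-congˡ (u₀·E≈M₀ j))) (v·E≈x'·M' j))
      where
      v : Vec D.rank
      v = proj₁ (D.image⊆span (tail x))
      v·E≈x'·M' : (v ·ᴹ D.basis) ≈ᵥ (tail x ·ᴹ tail M)
      v·E≈x'·M' = proj₂ (D.image⊆span (tail x))

    span⊆image : ∀ u → ∃ λ x → (x ·ᴹ M) ≈ᵥ (u ·ᴹ D.basis)
    span⊆image u = 0# ∷ x , λ j → trans (·ᴹ-head≈0 (0# ∷ x) M refl j) (x·M'≈u·E j)
      where
      x : Vec a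
      x = proj₁ (D.span⊆image u)
      x·M'≈u·E : (x ·ᴹ tail M) ≈ᵥ (u ·ᴹ D.basis)
      x·M'≈u·E = proj₂ (D.span⊆image u)

    -- The new row M₀ is the combination w of the others, so (1, -w) is a new kernel vector.
    kernel : Mat (suc D.nullity) (suc a)
    kernel = (1# ∷ negᵥ w) ∷ λ p → 0# ∷ D.kernel p

    kernel-head : ∀ x → (x ·ᴹ kernel) zero ≈ x zero
    kernel-head x = trans (+-cong (*-identityʳ (x zero)) (∑-*-zeroʳ (tail x))) (+-identityʳ (x zero))

    kernel-independent : Independent kernel
    kernel-independent x x·N≈0 = λ where
        zero    → x₀≈0
        (suc p) → D.kernel-independent (tail x) (λ j → trans (sym (·ᴹ-head≈0 x (tail ∘ kernel) x₀≈0 j)) (x·N≈0 (suc j))) p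
      where
      x₀≈0 : x zero ≈ 0#
      x₀≈0 = trans (sym (kernel-head x)) (x·N≈0 zero)

    kernel-annihilates : ∀ p → (kernel p ·ᴹ M) ≈ᵥ 0ᵥ
    kernel-annihilates zero    j = trans (+-cong (*-identityˡ (M zero j)) (trans (·ᴹ-negᵥ w (tail M) j) (-‿cong (w·M'≈M₀ j))))
                                         (-‿inverseʳ (M zero j))
    kernel-annihilates (suc p) j = trans (·ᴹ-head≈0 (kernel (suc p)) M refl j) (D.kernel-annihilates p j)

    kernel-spans : ∀ x → (x ·ᴹ M) ≈ᵥ 0ᵥ → InSpan kernel x
    kernel-spans x x·M≈0 = x zero ∷ v , λ where
        zero    → kernel-head (x zero ∷ v)
        (suc j) → trans (+-congˡ (v·N≈z j)) (cancel (x zero) (w j) (x (suc j)))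
      where
      z : Vec a
      z = (x zero *ᵥ w) +ᵥ tail x
      z·M'≈0 : (z ·ᴹ tail M) ≈ᵥ 0ᵥ
      z·M'≈0 j = trans (·ᴹ-distribʳ-+ᵥ (x zero *ᵥ w) (tail x) (tail M) j)
                       (trans (+-congʳ (trans (·ᴹ-*ᵥ (x zero) w (tail M) j) (*-congˡ (w·M'≈M₀ j)))) (x·M≈0 j))
      v : Vec D.nullity
      v = proj₁ (D.kernel-spans z z·M'≈0)
      v·N≈z : (v ·ᴹ D.kernel) ≈ᵥ z
      v·N≈z = proj₂ (D.kernel-spans z z·M'≈0)
      cancel : ∀ a b t → a * - b + (a * b + t) ≈ t
      cancel a b t = begin
        a * - b + (a * b + t)    ≈⟨ +-assoc (a * - b) (a * b) t ⟨
        a * - b + a * b + t      ≈⟨ +-congʳ (distribˡ a (- b) b) ⟨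
        a * (- b + b) + t        ≈⟨ +-congʳ (trans (*-congˡ (-‿inverseˡ b)) (zeroʳ a)) ⟩
        0# + t                   ≈⟨ +-identityˡ t ⟩
        t                        ∎

  rankNullity-∉span : ∀ {a b} (M : Mat (suc a) b) (D : RankNullity (tail M)) →
    ¬ InSpan (RankNullity.basis D) (M zero) → RankNullity M
  rankNullity-∉span {a} {b} M D M₀∉E = record
    { rank = suc D.rank ; nullity = D.nullity
    ; rank+nullity = ≡.cong suc D.rank+nullity
    ; basis = basis ; basis-independent = independent-∷ D.basis-independent M₀∉E
    ; image⊆span = image⊆span ; span⊆image = span⊆image
    ; row∈span = row∈span
    ; kernel = kernel ; kernel-independent = λ x x·N≈0 → D.kernel-independent x (x·N≈0 ∘ suc)
    ; kernel-annihilates = kernel-annihilates ; kernel-spans = kernel-spans }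
    where
    module D = RankNullity D
    basis : Mat (suc D.rank) b
    basis = M zero ∷ D.basis

    image⊆span : ∀ x → InSpan basis (x ·ᴹ M)
    image⊆span x = x zero ∷ proj₁ (D.image⊆span (tail x)) , +-congˡ ∘ proj₂ (D.image⊆span (tail x))

    span⊆image : ∀ u → ∃ λ x → (x ·ᴹ M) ≈ᵥ (u ·ᴹ basis)
    span⊆image u = u zero ∷ proj₁ (D.span⊆image (tail u)) , +-congˡ ∘ proj₂ (D.span⊆image (tail u))

    row∈span : ∀ i → InSpan basis (M i)
    row∈span zero    = 1# ∷ 0ᵥ , λ j → trans (+-cong (*-identityˡ (M zero j)) (·ᴹ-zeroˡ D.basis j)) (+-identityʳ _)
    row∈span (suc i) = 0# ∷ proj₁ (D.row∈span i) , λ j →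
      trans (·ᴹ-head≈0 (0# ∷ proj₁ (D.row∈span i)) basis refl j) (proj₂ (D.row∈span i) j)

    kernel : Mat D.nullity (suc a)
    kernel p = 0# ∷ D.kernel p

    kernel-annihilates : ∀ p → (kernel p ·ᴹ M) ≈ᵥ 0ᵥ
    kernel-annihilates p j = trans (·ᴹ-head≈0 (kernel p) M refl j) (D.kernel-annihilates p j)

    -- Independence of the new row forces the leading coefficient of a kernel vector to vanish.
    kernel-spans : ∀ x → (x ·ᴹ M) ≈ᵥ 0ᵥ → InSpan kernel x
    kernel-spans x x·M≈0 = v , λ where
        zero    → trans (∑-*-zeroʳ v) (sym x₀≈0)
        (suc j) → v·N≈x' j
      where
      u : Vec D.rank
      u = proj₁ (D.image⊆span (tail x))
      u·E≈x'·M' : (u ·ᴹ D.basis) ≈ᵥ (tail x ·ᴹ tail M)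
      u·E≈x'·M' = proj₂ (D.image⊆span (tail x))
      x₀≈0 : x zero ≈ 0#
      x₀≈0 = ∉span⇒leading≈0 M₀∉E (x zero) u λ j → trans (+-congˡ (u·E≈x'·M' j)) (x·M≈0 j)
      x'·M'≈0 : (tail x ·ᴹ tail M) ≈ᵥ 0ᵥ
      x'·M'≈0 j = trans (sym (·ᴹ-head≈0 x M x₀≈0 j)) (x·M≈0 j)
      v : Vec D.nullity
      v = proj₁ (D.kernel-spans (tail x) x'·M'≈0)
      v·N≈x' : (v ·ᴹ D.kernel) ≈ᵥ tail x
      v·N≈x' = proj₂ (D.kernel-spans (tail x) x'·M'≈0)

  rankNullity : ∀ {a b} (M : Mat a b) → RankNullity M
  rankNullity {zero} M = record
    { rank = 0 ; nullity = 0 ; rank+nullity = ≡.refl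
    ; basis = λ () ; basis-independent = λ _ _ ()
    ; image⊆span = λ _ → (λ ()) , λ _ → refl
    ; span⊆image = λ _ → (λ ()) , λ _ → refl
    ; row∈span = λ ()
    ; kernel = λ () ; kernel-independent = λ _ _ ()
    ; kernel-annihilates = λ ()
    ; kernel-spans = λ _ _ → (λ ()) , λ () }
  rankNullity {suc a} M with inSpan? (RankNullity.basis (rankNullity (tail M))) (M zero)
  ... | yes M₀∈E = rankNullity-∈span M (rankNullity (tail M)) M₀∈E
  ... | no  M₀∉E = rankNullity-∉span M (rankNullity (tail M)) M₀∉E

  module _ {a b} {M : Mat a b} (D : RankNullity M) where
    open RankNullity D

    -- Writing M = C · basis gives Mᵀ = basisᵀ · Cᵀ.
    ·ᴹᵀ-determined-by-basis : ∀ x y → (x ·ᴹ basis ᵀ) ≈ᵥ (y ·ᴹ basis ᵀ) → (x ·ᴹ M ᵀ) ≈ᵥ (y ·ᴹ M ᵀ)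
    ·ᴹᵀ-determined-by-basis x y e j = trans (factor x j) (trans (·ᴹ-congˡ (C ᵀ) e j) (sym (factor y j)))
      where
      C : Mat a rank
      C i = proj₁ (row∈span i)
      factor : ∀ x → (x ·ᴹ M ᵀ) ≈ᵥ ((x ·ᴹ basis ᵀ) ·ᴹ C ᵀ)
      factor x j = begin
        (x ·ᴹ M ᵀ) j                  ≈⟨ ·ᴹ-congʳ x (λ t i → sym (proj₂ (row∈span i) t)) j ⟩
        (x ·ᴹ (C ·ᴹᴹ basis) ᵀ) j      ≈⟨ ·ᴹ-congʳ x (·ᴹᴹ-ᵀ C (basis ᵀ)) j ⟩
        (x ·ᴹ (basis ᵀ ·ᴹᴹ C ᵀ)) j    ≈⟨ ·ᴹ-assoc x (basis ᵀ) (C ᵀ) j ⟩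
        ((x ·ᴹ basis ᵀ) ·ᴹ C ᵀ) j     ∎

    independentᵀ⇒≤rank : Independent (M ᵀ) → b ≤ rank
    independentᵀ⇒≤rank Mᵀ-independent = independent⇒≤ {E = basis ᵀ} λ x x·Eᵀ≈0 → Mᵀ-independent x λ j →
      trans (·ᴹᵀ-determined-by-basis x 0ᵥ (λ t → trans (x·Eᵀ≈0 t) (sym (·ᴹ-zeroˡ (basis ᵀ) t))) j)
            (·ᴹ-zeroˡ (M ᵀ) j)

  -- Images of affine sources

  ·ᵀ-affine : ∀ {k n m} (K : Mat m n) (A : Mat k n) (a : Vec n) (x : Vec k) →
    (K ·ᵀ ((x ·ᴹ A) +ᵥ a)) ≈ᵥ ((x ·ᴹ (A ·ᴹᴹ K ᵀ)) +ᵥ (K ·ᵀ a))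
  ·ᵀ-affine K A a x i = begin
    (K ·ᵀ ((x ·ᴹ A) +ᵥ a)) i               ≈⟨ ·ᵀ≈·ᴹᵀ K ((x ·ᴹ A) +ᵥ a) i ⟩
    (((x ·ᴹ A) +ᵥ a) ·ᴹ K ᵀ) i             ≈⟨ ·ᴹ-distribʳ-+ᵥ (x ·ᴹ A) a (K ᵀ) i ⟩
    ((x ·ᴹ A) ·ᴹ K ᵀ) i + (a ·ᴹ K ᵀ) i     ≈⟨ +-cong (·ᴹ-assoc x A (K ᵀ) i) (·ᵀ≈·ᴹᵀ K a i) ⟨
    (x ·ᴹ (A ·ᴹᴹ K ᵀ)) i + (K ·ᵀ a) i      ∎

  module _ {k n m} (X : AffineSource k n) (K : Mat m n) where
    open AffineSource X

    image-cong : ∀ {x y} → (x ·ᴹ (A ·ᴹᴹ K ᵀ)) ≈ᵥ (y ·ᴹ (A ·ᴹᴹ K ᵀ)) → (K ·ᵀ point x) ≈ᵥ (K ·ᵀ point y)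
    image-cong {x} {y} e i = trans (·ᵀ-affine K A a x i) (trans (+-congʳ (e i)) (sym (·ᵀ-affine K A a y i)))

    image-cancel : ∀ {x y} → (K ·ᵀ point x) ≈ᵥ (K ·ᵀ point y) → (x ·ᴹ (A ·ᴹᴹ K ᵀ)) ≈ᵥ (y ·ᴹ (A ·ᴹᴹ K ᵀ))
    image-cancel {x} {y} e i =
      +-cancelʳ ((K ·ᵀ a) i) _ _ (trans (sym (·ᵀ-affine K A a x i)) (trans (e i) (·ᵀ-affine K A a y i)))

  EntropyAtLeast-rank : ∀ {d n m} (Y : AffineSource d n) (K : Mat m n) (D : RankNullity (AffineSource.A Y ·ᴹᴹ K ᵀ)) →
    EntropyAtLeast K Y (RankNullity.rank D)
  EntropyAtLeast-rank {d} Y K D =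
    CardAtLeast-injection (supportImage K Y) (λ u → K ·ᵀ point (preimage u)) (λ u → preimage u , λ _ → refl)
      λ u v e → independent⇒injective basis-independent λ j →
        trans (sym (proj₂ (span⊆image u) j)) (trans (image-cancel Y K e j) (proj₂ (span⊆image v) j))
    where
    open RankNullity D
    open AffineSource Y using (point)
    preimage : Vec rank → Vec d
    preimage u = proj₁ (span⊆image u)

  EntropyAtLeast⇒≤rank : ∀ {k n m t} (X : AffineSource k n) (K : Mat m n) (D : RankNullity (K ·ᴹᴹ AffineSource.A X ᵀ)) →
    EntropyAtLeast K X t → t ≤ RankNullity.rank D
  EntropyAtLeast⇒≤rank {k} {t = t} X K D (f , f∈S , f-injective) =
    ^-cancelʳ-≤ (injection⇒≤ (λ i → preimage i ·ᴹ basis ᵀ) λ i j e → f-injective i j λ t →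
      trans (proj₂ (f∈S i) t) (trans (image-cong X K (AKᵀ-determined e) t) (sym (proj₂ (f∈S j) t))))
    where
    open RankNullity D
    open AffineSource X using (A)
    preimage : Fin (q ℕ.^ t) → Vec k
    preimage i = proj₁ (f∈S i)
    AKᵀ-determined : ∀ {x y} → (x ·ᴹ basis ᵀ) ≈ᵥ (y ·ᴹ basis ᵀ) → (x ·ᴹ (A ·ᴹᴹ K ᵀ)) ≈ᵥ (y ·ᴹ (A ·ᴹᴹ K ᵀ))
    AKᵀ-determined {x} {y} e t = begin
      (x ·ᴹ (A ·ᴹᴹ K ᵀ)) t       ≈⟨ ·ᴹ-congʳ x (·ᴹᴹ-ᵀ K A) t ⟨
      (x ·ᴹ (K ·ᴹᴹ A ᵀ) ᵀ) t     ≈⟨ ·ᴹᵀ-determined-by-basis D x y e t ⟩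
      (y ·ᴹ (K ·ᴹᴹ A ᵀ) ᵀ) t     ≈⟨ ·ᴹ-congʳ y (·ᴹᴹ-ᵀ K A) t ⟩
      (y ·ᴹ (A ·ᴹᴹ K ᵀ)) t       ∎

  direction-in-dual : ∀ {d k n} (Y : AffineSource d n) {A : Mat k n} (b : Vec n) →
    (∀ y → InDual A (AffineSource.point Y y -ᵥ b)) → ∀ y → ((y ·ᴹ AffineSource.A Y) ·ᴹ A ᵀ) ≈ᵥ 0ᵥ
  direction-in-dual {k = k} Y {A} b Y-b∈A⊥ y l = begin
    ((y ·ᴹ B) ·ᴹ A ᵀ) l              ≈⟨ +-identityʳ _ ⟨
    ((y ·ᴹ B) ·ᴹ A ᵀ) l + 0#         ≈⟨ +-congˡ offset≈0 ⟨
    ((y ·ᴹ B) ·ᴹ A ᵀ) l + offset l   ≈⟨ split y l ⟨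
    ((point y -ᵥ b) ·ᴹ A ᵀ) l        ≈⟨ Y-b∈A⊥ y l ⟩
    0#                               ∎
    where
    open AffineSource Y renaming (A to B)
    offset : Vec k
    offset = (a -ᵥ b) ·ᴹ A ᵀ
    split : ∀ y l → ((point y -ᵥ b) ·ᴹ A ᵀ) l ≈ ((y ·ᴹ B) ·ᴹ A ᵀ) l + offset l
    split y l = trans (·ᴹ-congˡ (A ᵀ) (λ j → +-assoc ((y ·ᴹ B) j) (a j) (- b j)) l)
                      (·ᴹ-distribʳ-+ᵥ (y ·ᴹ B) (a -ᵥ b) (A ᵀ) l)
    offset≈0 : offset l ≈ 0#
    offset≈0 = begin
      offset l                              ≈⟨ +-identityˡ (offset l) ⟨
      0# + offset l                         ≈⟨ +-congʳ (trans (·ᴹ-congˡ (A ᵀ) (·ᴹ-zeroˡ B) l) (·ᴹ-zeroˡ (A ᵀ) l)) ⟨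
      ((0ᵥ ·ᴹ B) ·ᴹ A ᵀ) l + offset l       ≈⟨ split 0ᵥ l ⟨
      ((point 0ᵥ -ᵥ b) ·ᴹ A ᵀ) l            ≈⟨ Y-b∈A⊥ 0ᵥ l ⟩
      0#                                    ∎

  ⊥-complement⊆span : ∀ {m h n} {G : Mat m n} {H : Mat h n} → Independent G → Independent H → n ≤ m ℕ.+ h →
    (∀ i → (G i ·ᴹ H ᵀ) ≈ᵥ 0ᵥ) → ∀ v → (v ·ᴹ H ᵀ) ≈ᵥ 0ᵥ → InSpan G v
  ⊥-complement⊆span {m} {h} {n} {G} {H} G-independent H-independent n≤m+h G⊥H v v⊥H = u , λ j → begin
    (u ·ᴹ G) j                ≈⟨ ·ᴹ-congʳ u (λ i t → sym (C·N≈G i t)) j ⟩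
    (u ·ᴹ (C ·ᴹᴹ kernel)) j   ≈⟨ ·ᴹ-assoc u C kernel j ⟩
    ((u ·ᴹ C) ·ᴹ kernel) j    ≈⟨ ·ᴹ-congˡ kernel u·C≈w j ⟩
    (w ·ᴹ kernel) j           ≈⟨ w·N≈v j ⟩
    v j                       ∎
    where
    D : RankNullity (H ᵀ)
    D = rankNullity (H ᵀ)
    open RankNullity D
    nullity≤m : nullity ≤ m
    nullity≤m = ℕₚ.+-cancelˡ-≤ rank nullity m (ℕₚ.≤-trans (ℕₚ.≤-reflexive rank+nullity)
      (ℕₚ.≤-trans n≤m+h (ℕₚ.≤-trans (ℕₚ.+-monoʳ-≤ m (independentᵀ⇒≤rank D H-independent))
        (ℕₚ.≤-reflexive (ℕₚ.+-comm m rank)))))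
    C : Mat m nullity
    C i = proj₁ (kernel-spans (G i) (G⊥H i))
    C·N≈G : ∀ i → (C i ·ᴹ kernel) ≈ᵥ G i
    C·N≈G i = proj₂ (kernel-spans (G i) (G⊥H i))
    w : Vec nullity
    w = proj₁ (kernel-spans v v⊥H)
    w·N≈v : (w ·ᴹ kernel) ≈ᵥ v
    w·N≈v = proj₂ (kernel-spans v v⊥H)
    w∈C : InSpan C w
    w∈C = independent-spans C (independent-of-factor C·N≈G G-independent) nullity≤m w
    u : Vec m
    u = proj₁ w∈C
    u·C≈w : (u ·ᴹ C) ≈ᵥ w
    u·C≈w = proj₂ w∈C

  nullity-≤ : ∀ {d k m h n} {B : Mat d n} {A : Mat k n} {G : Mat m n} {H : Mat h n} →
    Independent B → (∀ y → ((y ·ᴹ B) ·ᴹ A ᵀ) ≈ᵥ 0ᵥ) → (∀ v → (v ·ᴹ H ᵀ) ≈ᵥ 0ᵥ → InSpan G v) →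
    (D₁ : RankNullity (B ·ᴹᴹ H ᵀ)) (D₂ : RankNullity (G ·ᴹᴹ A ᵀ)) →
    RankNullity.nullity D₁ ≤ RankNullity.nullity D₂
  nullity-≤ {m = m} {n = n} {B} {A} {G} {H} B-independent B⊥A H⊥⊆G D₁ D₂ =
    independent-rows-in-span⇒≤ Z-independent λ p → D₂.kernel-spans (Z p) λ l → begin
      (Z p ·ᴹ (G ·ᴹᴹ A ᵀ)) l   ≈⟨ ·ᴹ-assoc (Z p) G (A ᵀ) l ⟩
      ((Z p ·ᴹ G) ·ᴹ A ᵀ) l    ≈⟨ ·ᴹ-congˡ (A ᵀ) (Z·G≈V p) l ⟩
      (V p ·ᴹ A ᵀ) l           ≈⟨ B⊥A (D₁.kernel p) l ⟩
      0#                       ∎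
    where
    module D₁ = RankNullity D₁
    module D₂ = RankNullity D₂
    V : Mat D₁.nullity n
    V = D₁.kernel ·ᴹᴹ B
    V⊥H : ∀ p → (V p ·ᴹ H ᵀ) ≈ᵥ 0ᵥ
    V⊥H p j = trans (sym (·ᴹ-assoc (D₁.kernel p) B (H ᵀ) j)) (D₁.kernel-annihilates p j)
    Z : Mat D₁.nullity m
    Z p = proj₁ (H⊥⊆G (V p) (V⊥H p))
    Z·G≈V : ∀ p → (Z p ·ᴹ G) ≈ᵥ V p
    Z·G≈V p = proj₂ (H⊥⊆G (V p) (V⊥H p))
    Z-independent : Independent Z
    Z-independent = independent-of-factor Z·G≈V (independent-·ᴹᴹ D₁.kernel-independent B-independent)

open import Data.Nat using (_+_; _∸_)

theorem5p10 : {c ℓ : Level} (F : FiniteField c ℓ) →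
    let open FieldOps F in
    IsPrimePower q →
    (m n k k' : ℕ) → m ≤ n →
    (G : Mat m n) → HasRank= G m →
    (X : AffineSource k n) →
    IsCondenser G X k' →
    (H : Mat (n ∸ m) n) → HasRank= H (n ∸ m) → OrthRows G H →
    (Y : AffineSource (n ∸ k) n) →
    (b : Vec n) → (∀ y → InDual (AffineSource.A X) (AffineSource.point Y y -ᵥ b)) →
    EntropyAtLeast H Y (n ∸ k + k' ∸ m)
theorem5p10 F _ m n k k' _ G (_ , G-independent) X condenser H (_ , H-independent) G⊥H Y b Y-b⊥X =
  EntropyAtLeast-mono {K = H} {Y} (rank-nullity-bound D₁.rank+nullity D₂.rank+nullity nullity₁≤nullity₂ k'≤rank₂)
    (EntropyAtLeast-rank Y H D₁)
  where
  open FieldOps F using (AffineSource)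
  open LinearAlgebra F
  D₁ : RankNullity (AffineSource.A Y ·ᴹᴹ H ᵀ)
  D₁ = rankNullity (AffineSource.A Y ·ᴹᴹ H ᵀ)
  D₂ : RankNullity (G ·ᴹᴹ AffineSource.A X ᵀ)
  D₂ = rankNullity (G ·ᴹᴹ AffineSource.A X ᵀ)
  module D₁ = RankNullity D₁
  module D₂ = RankNullity D₂
  nullity₁≤nullity₂ : D₁.nullity ≤ D₂.nullity
  nullity₁≤nullity₂ = nullity-≤ (proj₂ (AffineSource.rankA Y)) (direction-in-dual Y b Y-b⊥X)
    (⊥-complement⊆span G-independent H-independent (ℕₚ.m≤n+m∸n n m) G⊥H) D₁ D₂
  k'≤rank₂ : k' ≤ D₂.rank
  k'≤rank₂ = EntropyAtLeast⇒≤rank X G D₂ condenser
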